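{- Let $n\ge 1$, $D=\{0,\dots,n-1\}$, and fix a vectorization of $n\times n$ multiplication tables, i.e.\ an enumeration $(r_1,c_1),\dots,(r_{n^2},c_{n^2})$ of all cells of $D\times D$. Let $A=(D,\ast)$ be a magma that is minimal with respect to the set of all transpositions, i.e.\ $A\preceq\tau(A)$ for every transposition $\tau\in S_n$. Then $A$ satisfies the least number heuristic (LNH) with respect to this vectorization.
   Context: A magma $A=(D,\ast)$ is a set $D$ with a binary operation; write $A(r,c)=r\ast c$. For a permutation $\pi$ of $D$, the isomorphic copy $\pi(A)$ is the magma on $D$ with $\pi(A)(a,b)=\pi\big(A(\pi^{ -1}(a),\pi^{ -1}(b))\big)$. Given the fixed enumeration of cells, the vector of $A$ is $\big(A(r_1,c_1),\dots,A(r_{n^2},c_{n^2})\big)$, and $A\preceq B$ means the vector of $A$ is lexicographically smaller than or equal to that of $B$ (with the usual order on $D$); $A\prec B$ means $A\preceq B$ and the vectors differ. A transposition is a permutation of $D$ swapping two elements and fixing all others. The least number heuristic: $A$ satisfies LNH if for every $i\in\{1,\dots,n^2\}$, $A(r_i,c_i)\le 1+\max\big(\{r_j,c_j: j\le i\}\cup\{A(r_j,c_j): j<i\}\big)$, i.e.\ each cell's value is either a value already "seen" (occurring as a row/column index of a cell up to position $i$ or as a value in an earlier cell) or the smallest not-yet-seen value. -}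

module Defs where

open import Data.Nat using (ℕ; zero; suc; _*_; _≤_; _<_)
open import Data.Fin using (Fin; toℕ)
open import Data.Fin.Permutation using (Permutation′; _⟨$⟩ʳ_; _⟨$⟩ˡ_)
open import Data.Product using (_×_; _,_; proj₁; proj₂; ∃-syntax)
open import Data.Sum using (_⊎_)
open import Function.Bundles using (_↔_; Inverse)
open import Relation.Binary.PropositionalEquality using (_≡_)

Magma : ℕ → Set
Magma n = Fin n → Fin n → Fin n

-- A vectorization: an enumeration of all cells of D × D, i.e. a bijection
-- between positions {1,…,n²} (here Fin (n * n), 0-based) and cells.
Vectorization : ℕ → Set
Vectorization n = Fin (n * n) ↔ (Fin n × Fin n)

module _ {n : ℕ} (V : Vectorization n) where

  cell : Fin (n * n) → Fin n × Fin n
  cell = Inverse.to V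

  row col : Fin (n * n) → Fin n
  row i = proj₁ (cell i)
  col i = proj₂ (cell i)

  vec : Magma n → Fin (n * n) → Fin n
  vec A i = A (row i) (col i)

  _⪯_ : Magma n → Magma n → Set
  A ⪯ B = (∀ i → vec A i ≡ vec B i)
        ⊎ (∃[ i ] ((∀ j → toℕ j < toℕ i → vec A j ≡ vec B j)
                   × toℕ (vec A i) < toℕ (vec B i)))

  Seen : Magma n → Fin (n * n) → ℕ → Set
  Seen A i x = (∃[ j ] (toℕ j ≤ toℕ i × (x ≡ toℕ (row j) ⊎ x ≡ toℕ (col j))))
             ⊎ (∃[ j ] (toℕ j < toℕ i × x ≡ toℕ (vec A j)))

  -- LNH: A(r_i,c_i) ≤ 1 + max (Seen A i).  Since Seen A i is a nonempty
  -- finite set, this is written as: some seen value s has A(r_i,c_i) ≤ 1 + s.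
  LNH : Magma n → Set
  LNH A = ∀ i → ∃[ s ] (Seen A i s × toℕ (vec A i) ≤ suc s)

_·_ : ∀ {n} → Permutation′ n → Magma n → Magma n
(π · A) a b = π ⟨$⟩ʳ A (π ⟨$⟩ˡ a) (π ⟨$⟩ˡ b)

{-# OPTIONS --safe #-}
-- If the value v of cell i is new, and some w < v is not seen at i either, then the
-- transposition (w v) fixes every row, column and value seen up to cell i.  Hence
-- (w v)(A) agrees with A before cell i and has the smaller value w at cell i, so
-- (w v)(A) ≺ A, contradicting minimality.  Thus every value below a new value is
-- already seen, which is the least number heuristic.
module Submission where

open import Defs
open import Data.Nat using (ℕ; _*_; _≥_; _≤_; _<_; suc; z≤n; s≤s; _≤?_) renaming (_≟_ to _≟ℕ_)
open import Data.Nat.Properties using (n≤1+n; ≤-reflexive; <⇒≤; ≤-refl; <⇒≢; <-asym; <-cmp)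
open import Data.Fin using (Fin; toℕ; zero; suc; inject₁)
open import Data.Fin.Properties using (any?; toℕ-injective; toℕ-inject₁; _≟_) renaming (<⇒≢ to <⇒≢ᶠ)
open import Data.Fin.Permutation using (Permutation′; _⟨$⟩ʳ_; _⟨$⟩ˡ_; inverseˡ; transpose)
import Data.Fin.Permutation.Components as Components
open import Data.Product using (∃; ∃-syntax; _×_; _,_)
open import Data.Sum using (_⊎_; inj₁; inj₂)
open import Data.Empty using (⊥-elim)
open import Relation.Binary.Definitions using (tri<; tri≈; tri>)
open import Relation.Binary.PropositionalEquality using (_≡_; _≢_; refl; sym; trans; cong; cong₂)
open import Relation.Nullary using (¬_; Dec; yes; no)
open import Relation.Nullary.Decidable using (_×-dec_; _⊎-dec_; dec-true; dec-false)

transpose-fixes : ∀ {n} {a b x : Fin n} → x ≢ a → x ≢ b → Components.transpose a b x ≡ x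
transpose-fixes {a = a} {b} {x} x≢a x≢b rewrite dec-false (x ≟ a) x≢a | dec-false (x ≟ b) x≢b = refl

transpose-maps-second : ∀ {n} {a b : Fin n} → b ≢ a → Components.transpose a b b ≡ a
transpose-maps-second {a = a} {b} b≢a rewrite dec-false (b ≟ a) b≢a | dec-true (b ≟ b) refl = refl

inverse-fixes : ∀ {n} (π : Permutation′ n) {x : Fin n} → π ⟨$⟩ʳ x ≡ x → π ⟨$⟩ˡ x ≡ x
inverse-fixes π {x} πx≡x = trans (cong (π ⟨$⟩ˡ_) (sym πx≡x)) (inverseˡ π)

≤-suc-witness : ∀ {n} {P : ℕ → Set} → ∃ P → (v : Fin n)
  → (∀ (w : Fin n) → toℕ w < toℕ v → P (toℕ w) ⊎ P (toℕ v))
  → ∃[ s ] (P s × toℕ v ≤ suc s)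
≤-suc-witness (s , Ps) zero    _     = s , Ps , z≤n
≤-suc-witness _        (suc u) below with below (inject₁ u) (s≤s (≤-reflexive (toℕ-inject₁ u)))
... | inj₁ Pu = toℕ (inject₁ u) , Pu , s≤s (≤-reflexive (sym (toℕ-inject₁ u)))
... | inj₂ Pv = toℕ (suc u) , Pv , n≤1+n _

module _ {n : ℕ} (V : Vectorization n) where

  ⋠-at-first-decrease : ∀ {A B : Magma n} i
    → (∀ j → toℕ j < toℕ i → vec V B j ≡ vec V A j)
    → toℕ (vec V B i) < toℕ (vec V A i)
    → ¬ _⪯_ V A B
  ⋠-at-first-decrease i _ B<A (inj₁ A≡B) = <⇒≢ B<A (cong toℕ (sym (A≡B i)))
  ⋠-at-first-decrease i agree B<A (inj₂ (k , agree′ , A<B)) with <-cmp (toℕ k) (toℕ i)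
  ... | tri< k<i _ _ = <⇒≢ A<B (cong toℕ (sym (agree k k<i)))
  ... | tri> _ _ i<k = <⇒≢ B<A (cong toℕ (sym (agree′ i i<k)))
  ... | tri≈ _ k≡i _ with toℕ-injective k≡i
  ...   | refl = <-asym A<B B<A

  vec-· : ∀ (π : Permutation′ n) (A : Magma n) j
    → π ⟨$⟩ʳ row V j ≡ row V j → π ⟨$⟩ʳ col V j ≡ col V j
    → vec V (π · A) j ≡ π ⟨$⟩ʳ vec V A j
  vec-· π A j πr≡r πc≡c = cong (π ⟨$⟩ʳ_) (cong₂ A (inverse-fixes π πr≡r) (inverse-fixes π πc≡c))

  module _ (A : Magma n) where

    seen? : ∀ i x → Dec (Seen V A i x)
    seen? i x =
      any? (λ j → (toℕ j ≤? toℕ i) ×-dec ((x ≟ℕ toℕ (row V j)) ⊎-dec (x ≟ℕ toℕ (col V j))))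
      ⊎-dec any? (λ j → (suc (toℕ j) ≤? toℕ i) ×-dec (x ≟ℕ toℕ (vec V A j)))

    module _ (π : Permutation′ n) (i : Fin (n * n))
             (fixes-seen : ∀ x → Seen V A i (toℕ x) → π ⟨$⟩ʳ x ≡ x) where

      private
        vec-·-upto : ∀ j → toℕ j ≤ toℕ i → vec V (π · A) j ≡ π ⟨$⟩ʳ vec V A j
        vec-·-upto j j≤i = vec-· π A j (fixes-seen (row V j) (inj₁ (j , j≤i , inj₁ refl)))
                                       (fixes-seen (col V j) (inj₁ (j , j≤i , inj₂ refl)))

      ·-agrees-before : ∀ j → toℕ j < toℕ i → vec V (π · A) j ≡ vec V A j
      ·-agrees-before j j<i = trans (vec-·-upto j (<⇒≤ j<i)) (fixes-seen (vec V A j) (inj₂ (j , j<i , refl)))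

      ·-at : vec V (π · A) i ≡ π ⟨$⟩ʳ vec V A i
      ·-at = vec-·-upto i ≤-refl

    minimal⇒smaller-values-seen : (∀ (a b : Fin n) → a ≢ b → _⪯_ V A (transpose a b · A))
      → ∀ i w → toℕ w < toℕ (vec V A i)
      → Seen V A i (toℕ w) ⊎ Seen V A i (toℕ (vec V A i))
    minimal⇒smaller-values-seen minimal i w w<v with seen? i (toℕ w) | seen? i (toℕ (vec V A i))
    ... | yes w-seen | _          = inj₁ w-seen
    ... | no _       | yes v-seen = inj₂ v-seen
    ... | no w-new   | no v-new   =
      ⊥-elim (⋠-at-first-decrease {A} {τ · A} i (·-agrees-before τ i τ-fixes-seen) τA<A (minimal w v w≢v))
      where
        v : Fin n
        v = vec V A i

        τ : Permutation′ n
        τ = transpose w v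

        w≢v : w ≢ v
        w≢v = <⇒≢ᶠ w<v

        τ-fixes-seen : ∀ x → Seen V A i (toℕ x) → τ ⟨$⟩ʳ x ≡ x
        τ-fixes-seen x x-seen = transpose-fixes (λ { refl → w-new x-seen }) (λ { refl → v-new x-seen })

        τA<A : toℕ (vec V (τ · A) i) < toℕ v
        τA<A rewrite ·-at τ i τ-fixes-seen | transpose-maps-second (λ v≡w → w≢v (sym v≡w)) = w<v

proposition1 : (n : ℕ) → n ≥ 1 → (V : Vectorization n) → (A : Magma n)
    → (∀ (a b : Fin n) → a ≢ b → _⪯_ V A (transpose a b · A))
    → LNH V A
proposition1 n _ V A minimal i =
  ≤-suc-witness (toℕ (row V i) , inj₁ (i , ≤-refl , inj₁ refl)) (vec V A i)
                (minimal⇒smaller-values-seen V A minimal i)
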